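{- If $G$ is vertex-transitive and $H$ is any graph, then $$\alpha^*(G|H)=\frac{|\mathcal V(G)|}{\alpha(G^c\boxtimes H)}=\frac{|\mathcal V(G)|}{|\mathcal V(H)|}\cdot\frac{|\mathcal V(H)|}{\alpha(G^c\boxtimes H)}\le \frac{|\mathcal V(G)|}{|\mathcal V(H)|}\,\alpha^*(H^c|G^c),$$ with equality in the last inequality if both $G$ and $H$ are vertex-transitive. If both $G$ and $H$ are vertex-transitive, then moreover $\alpha^*(G|H)=\dfrac{\chi_f(G^c\boxtimes H)}{|\mathcal V(H)|}$.
   Context: All graphs are finite, simple, undirected; $G^c$ is the complement, $\boxtimes$ the strong product, $\alpha$ the independence number, $\chi_f$ the fractional chromatic number. $\alpha^*(G|H)=\sup_W\frac{\alpha(G\boxtimes W)}{\alpha(H\boxtimes W)}$ over all graphs $W$. Vertex-transitive means the automorphism group acts transitively on vertices. -}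

module Defs where

open import Data.Bool using (Bool; true; false; not; _∧_; _∨_)
open import Data.Nat using (ℕ; zero; suc; _*_; _≤_; _<_; _⊔_)
open import Data.Fin using (Fin; remQuot; _≟_)
open import Data.Fin.Properties using (all?)
open import Data.Fin.Subset using (Subset; _∈_; ∣_∣)
open import Data.Fin.Subset.Properties using (_∈?_)
open import Data.Vec using (_∷_; [])
open import Data.List using (List; []; _∷_; map; _++_; filter; foldr)
open import Data.Nat.ListAction using (sum)
open import Data.List.Relation.Unary.All using (All)
open import Data.Product using (Σ; _×_; _,_; proj₁; proj₂; ∃)
open import Data.Fin.Permutation using (Permutation′; _⟨$⟩ʳ_)
open import Relation.Binary.PropositionalEquality using (_≡_)
open import Relation.Nullary using (Dec; _→-dec_)
open import Relation.Nullary.Decidable using (⌊_⌋)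
open import Data.Bool.Properties renaming (_≟_ to _≟B_)

record Graph : Set where
  constructor graph
  field
    n   : ℕ
    adj : Fin n → Fin n → Bool
open Graph public

IsSimple : Graph → Set
IsSimple G = (∀ i j → adj G i j ≡ adj G j i) × (∀ i → adj G i i ≡ false)

∣V∣ : Graph → ℕ
∣V∣ G = n G

infix 30 _ᶜ
infixl 20 _⊠_

_ᶜ : Graph → Graph
G ᶜ = graph (n G) (λ i j → not (adj G i j) ∧ not ⌊ i ≟ j ⌋)

-- Strong product G ⊠ H on Fin (n G * n H), a vertex x coding the pair remQuot x.
_⊠_ : Graph → Graph → Graph
G ⊠ H = graph (n G * n H) λ x y →
  let (u , v)   = remQuot (n H) x
      (u′ , v′) = remQuot (n H) y
  in not ⌊ x ≟ y ⌋ ∧ (⌊ u ≟ u′ ⌋ ∨ adj G u u′) ∧ (⌊ v ≟ v′ ⌋ ∨ adj H v v′)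

Independent : (G : Graph) → Subset (n G) → Set
Independent G S = ∀ i j → i ∈ S → j ∈ S → adj G i j ≡ false

independent? : (G : Graph) (S : Subset (n G)) → Dec (Independent G S)
independent? G S =
  all? λ i → all? λ j → (i ∈? S) →-dec ((j ∈? S) →-dec (adj G i j ≟B false))

allSubsets : (k : ℕ) → List (Subset k)
allSubsets zero = [] ∷ []
allSubsets (suc k) = map (true ∷_) (allSubsets k) ++ map (false ∷_) (allSubsets k)

α : Graph → ℕ
α G = foldr _⊔_ 0 (map ∣_∣ (filter (independent? G) (allSubsets (n G))))

IsAutomorphism : (G : Graph) → Permutation′ (n G) → Set
IsAutomorphism G σ = ∀ i j → adj G (σ ⟨$⟩ʳ i) (σ ⟨$⟩ʳ j) ≡ adj G i j

VertexTransitive : Graph → Set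
VertexTransitive G =
  ∀ u v → Σ (Permutation′ (n G)) λ σ → IsAutomorphism G σ × (σ ⟨$⟩ʳ u ≡ v)

-- The graphs W over which α* takes its supremum (nonempty simple graphs,
-- so that the ratio α(G⊠W)/α(H⊠W) is defined).
Admissible : Graph → Set
Admissible W = IsSimple W × (1 ≤ n W)

-- "a/b is an upper bound for α(G⊠W)/α(H⊠W) over all W"
AlphaStarUB : Graph → Graph → ℕ → ℕ → Set
AlphaStarUB G H a b = ∀ W → Admissible W → α (G ⊠ W) * b ≤ a * α (H ⊠ W)

-- "a/b ≤ α*(G|H)": every rational p/q < a/b is exceeded by some ratio
AlphaStarLB : Graph → Graph → ℕ → ℕ → Set
AlphaStarLB G H a b = ∀ p q → 1 ≤ q → p * b < a * q →
  ∃ λ W → Admissible W × (p * α (H ⊠ W) < α (G ⊠ W) * q)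

AlphaStarIs : Graph → Graph → ℕ → ℕ → Set
AlphaStarIs G H a b = AlphaStarUB G H a b × AlphaStarLB G H a b

-- Fractional colourings with nonnegative rational weights c_S / d on independent sets S
record FracColouring (G : Graph) : Set where
  field
    sets   : List (Subset (n G) × ℕ)
    denom  : ℕ
    denom≥1 : 1 ≤ denom
    indep  : All (λ Sc → Independent G (proj₁ Sc)) sets
    covers : ∀ v → denom ≤ sum (map proj₂ (filter (λ Sc → v ∈? proj₁ Sc) sets))
open FracColouring public

-- total weight numerator (total weight = weightNum / denom)
weightNum : {G : Graph} → FracColouring G → ℕ
weightNum c = sum (map proj₂ (sets c))

-- χ_f(G) = a/b : a/b is the infimum of total weights of fractional colourings
FracChromIs : Graph → ℕ → ℕ → Set
FracChromIs G a b =
  (∀ (c : FracColouring G) → a * denom c ≤ weightNum c * b) ×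
  (∀ p q → 1 ≤ q → a * q < p * b →
     Σ (FracColouring G) λ c → weightNum c * q < p * denom c)

-- Let S and T be maximum independent sets of G ⊠ W and Gᶜ ⊠ H. For an automorphism σ of G,
-- the pairs (h , w) with (g , w) ∈ S and (σ g , h) ∈ T for some g form an independent set of
-- H ⊠ W, and g is unique: distinct g, g′ cannot be non-adjacent both in G and, after σ, in Gᶜ.
-- So α(H ⊠ W) ≥ ∑_g |S_g| |T_{σ g}|, where S_g, T_g are the rows of S and T. If G is
-- vertex-transitive, every vertex is sent to every vertex by |Aut G| / |V(G)| automorphisms,
-- and averaging over Aut G gives α(G ⊠ W) α(Gᶜ ⊠ H) ≤ |V(G)| α(H ⊠ W). The diagonal of
-- G ⊠ Gᶜ is independent, so W = Gᶜ attains this bound, and W = H attains the bound for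
-- α*(Hᶜ|Gᶜ); when H is vertex-transitive the matching upper bound is the same inequality for
-- Hᶜ. Finally, the images of a maximum independent set of a vertex-transitive graph K under
-- Aut K cover all vertices equally often, so χ_f(K) = |V(K)| / α(K); for K = Gᶜ ⊠ H this
-- rewrites |V(G)| / α(Gᶜ ⊠ H) as χ_f(Gᶜ ⊠ H) / |V(H)|.

module Submission where

open import Defs
open import Data.Nat using (ℕ; _*_; _≤_)
open import Data.Product using (_×_)

open import Data.Nat using (zero; suc; _+_; z≤n; s≤s; _⊔_; >-nonZero)
open import Data.Nat.Properties hiding (_≟_; suc-injective)
open import Data.Bool using (Bool; true; false; not; _∧_; _∨_)
import Data.Bool.Properties as Bool
open import Data.Bool.Properties using (∧-conicalˡ; ∧-conicalʳ; ∨-conicalˡ; ∨-conicalʳ; ∧-zeroʳ)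
open import Data.Empty using (⊥-elim)
open import Data.Sum using (_⊎_; inj₁; inj₂)
open import Data.Product using (∃; _,_; proj₁; proj₂; uncurry; swap)
open import Data.Vec as Vec using (Vec; []; _∷_; lookup; tabulate)
open import Data.Vec.Properties using (lookup∘tabulate; []=⇒lookup; lookup⇒[]=; lookup-map; lookup-allFin)
open import Data.Fin.Subset using (Subset; _∈_; ∣_∣; ⊤; ⊥)
open import Data.Fin.Subset.Properties using (∣⊤∣≡n; ∣⊥∣≡0; ∉⊥; _∈?_)
open import Data.List as List using (List; map; filter)
open import Data.Nat.ListAction using (sum)
open import Data.Nat.ListAction.Properties using (sum-++)
open import Data.List.Relation.Unary.All as All using (All)
open import Data.List.Relation.Unary.All.Properties using (all-filter) renaming (map⁺ to All-map⁺)
open import Data.List.Membership.Propositional using (lose) renaming (_∈_ to _∈ᴸ_)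
open import Data.List.Membership.Propositional.Properties
  using (∈-filter⁻; ∈-filter⁺; ∈-map⁺; ∈-map⁻; ∈-++⁺ˡ; ∈-++⁺ʳ; foldr-selective)
open import Data.List.Properties using (foldr-preservesᵒ; map-++; map-cong; map-∘)
open import Data.List.Relation.Unary.Any using (here)
open import Data.Fin as Fin using (Fin; combine; remQuot; _↑ˡ_; _↑ʳ_; _≟_)
open import Data.Fin.Properties
  using (all?; *↔×; remQuot-combine; combine-remQuot; combine-injective; suc-injective)
open import Relation.Nullary using (¬_; Dec; yes; no; does; contradiction)
open import Relation.Nullary.Decidable using (⌊_⌋; dec-true; dec-false; does-⇔; _×-dec_; _→-dec_)
open import Relation.Unary using (Decidable)
open import Relation.Binary.PropositionalEquality hiding ([_])
open import Function using (_∘_; id)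
open import Function.Bundles using (Injection; _⇔_; mk⇔)
open import Function.Properties.Inverse using (↔-trans; ↔-sym; ↔⇒↣)
open import Data.Product.Function.NonDependent.Propositional using (_×-↔_)
open import Data.Fin.Permutation using (Permutation′; _⟨$⟩ʳ_)
open import Function.Definitions using (Injective)
open import Algebra.Properties.CommutativeSemigroup *-commutativeSemigroup
  using () renaming (x∙yz≈y∙xz to x*[y*z]≡y*[x*z])
open import Algebra.Properties.Semiring.Sum +-*-semiring
  using (sum-syntax; sum-cong-≗; sum-replicate-zero; ∑-comm; ∑-distrib-+; ∑-permute;
         *-distribˡ-sum; *-distribʳ-sum)
  renaming (sum to ∑)

⌊⌋-true : ∀ {A : Set} (a? : Dec A) → A → ⌊ a? ⌋ ≡ true
⌊⌋-true (yes _) _ = refl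
⌊⌋-true (no ¬a) a = ⊥-elim (¬a a)

⌊⌋-false : ∀ {A : Set} (a? : Dec A) → ¬ A → ⌊ a? ⌋ ≡ false
⌊⌋-false (yes a) ¬a = ⊥-elim (¬a a)
⌊⌋-false (no _) _ = refl

⌊⌋-true⁻ : ∀ {A : Set} (a? : Dec A) → ⌊ a? ⌋ ≡ true → A
⌊⌋-true⁻ (yes a) _ = a

⌊⌋-false⁻ : ∀ {A : Set} (a? : Dec A) → ⌊ a? ⌋ ≡ false → ¬ A
⌊⌋-false⁻ (no ¬a) _ = ¬a

[_] : Bool → ℕ
[ true ] = 1
[ false ] = 0

∧-false-split : ∀ a b → a ∧ b ≡ false → a ≡ false ⊎ b ≡ false
∧-false-split false b _ = inj₁ refl
∧-false-split true b b≡false = inj₂ b≡false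

[∧] : ∀ a b → [ a ∧ b ] ≡ [ a ] * [ b ]
[∧] true b = sym (+-identityʳ [ b ])
[∧] false b = refl

∑-mono : ∀ {m} {f g : Fin m → ℕ} → (∀ i → f i ≤ g i) → ∑ f ≤ ∑ g
∑-mono {zero} f≤g = z≤n
∑-mono {suc m} f≤g = +-mono-≤ (f≤g Fin.zero) (∑-mono (f≤g ∘ Fin.suc))

∑-const : ∀ m c → ∑[ i < m ] c ≡ m * c
∑-const zero c = refl
∑-const (suc m) c = cong (c +_) (∑-const m c)

term≤∑ : ∀ {m} (f : Fin m → ℕ) i → f i ≤ ∑ f
term≤∑ f Fin.zero = m≤m+n _ _
term≤∑ f (Fin.suc i) = ≤-trans (term≤∑ (f ∘ Fin.suc) i) (m≤n+m _ _)

∑-↑ : ∀ k {l} (f : Fin (k + l) → ℕ) → ∑ f ≡ ∑[ i < k ] f (i ↑ˡ l) + ∑[ j < l ] f (k ↑ʳ j)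
∑-↑ zero f = refl
∑-↑ (suc k) f = trans (cong (f Fin.zero +_) (∑-↑ k (f ∘ Fin.suc))) (sym (+-assoc (f Fin.zero) _ _))

∑-combine : ∀ m {k} (f : Fin (m * k) → ℕ) → ∑ f ≡ ∑[ i < m ] ∑[ j < k ] f (combine i j)
∑-combine zero f = refl
∑-combine (suc m) {k} f =
  trans (∑-↑ k f) (cong (∑[ j < k ] f (j ↑ˡ (m * k)) +_) (∑-combine m (f ∘ (k ↑ʳ_))))

∑-δ : ∀ {m} (i : Fin m) (f : Fin m → ℕ) → ∑ (λ j → [ ⌊ i ≟ j ⌋ ] * f j) ≡ f i
∑-δ {suc m} Fin.zero f =
  trans (cong₂ _+_ (+-identityʳ (f Fin.zero)) (sum-replicate-zero m)) (+-identityʳ (f Fin.zero))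
∑-δ {suc m} (Fin.suc i) f =
  trans (sum-cong-≗ (λ j → cong (λ b → [ b ] * f (Fin.suc j)) (≟-suc j))) (∑-δ i (f ∘ Fin.suc))
  where
  ≟-suc : ∀ j → ⌊ Fin.suc i ≟ Fin.suc j ⌋ ≡ ⌊ i ≟ j ⌋
  ≟-suc j with i ≟ j
  ... | yes _ = refl
  ... | no _ = refl

any : ∀ {m} → (Fin m → Bool) → Bool
any {zero} f = false
any {suc m} f = f Fin.zero ∨ any (f ∘ Fin.suc)

any-witness : ∀ {m} (f : Fin m → Bool) → any f ≡ true → ∃ λ i → f i ≡ true
any-witness {suc m} f e with f Fin.zero in f0
... | true = Fin.zero , f0
... | false = let i , fi = any-witness (f ∘ Fin.suc) e in Fin.suc i , fi

∑[]≤[any] : ∀ {m} (f : Fin m → Bool) → (∀ i j → f i ≡ true → f j ≡ true → i ≡ j) →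
  ∑ (λ i → [ f i ]) ≤ [ any f ]
∑[]≤[any] {zero} f unique = z≤n
∑[]≤[any] {suc m} f unique with f Fin.zero in f0
... | true = s≤s (≤-reflexive (trans (sum-cong-≗ rest-false) (sum-replicate-zero m)))
  where
  rest-false : ∀ i → [ f (Fin.suc i) ] ≡ 0
  rest-false i with f (Fin.suc i) in fi
  ... | true with () ← unique Fin.zero (Fin.suc i) f0 fi
  ... | false = refl
... | false = ∑[]≤[any] (f ∘ Fin.suc) (λ i j fi fj → suc-injective (unique _ _ fi fj))

module _ {A : Set} where

  sum-map-mono : ∀ {P : A → Set} {f g : A → ℕ} {xs} → All P xs → (∀ x → P x → f x ≤ g x) →
    sum (map f xs) ≤ sum (map g xs)
  sum-map-mono All.[] f≤g = z≤n
  sum-map-mono (px All.∷ pxs) f≤g = +-mono-≤ (f≤g _ px) (sum-map-mono pxs f≤g)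

  sum-map-*ˡ : ∀ c (f : A → ℕ) xs → c * sum (map f xs) ≡ sum (map (λ x → c * f x) xs)
  sum-map-*ˡ c f List.[] = *-zeroʳ c
  sum-map-*ˡ c f (x List.∷ xs) = trans (*-distribˡ-+ c (f x) _) (cong (c * f x +_) (sum-map-*ˡ c f xs))

  sum-map-*ʳ : ∀ c (f : A → ℕ) xs → sum (map f xs) * c ≡ sum (map (λ x → f x * c) xs)
  sum-map-*ʳ c f xs =
    trans (*-comm _ c) (trans (sum-map-*ˡ c f xs) (cong sum (map-cong (λ x → *-comm c (f x)) xs)))

  ∑-sum-map : ∀ {m} (F : Fin m → A → ℕ) xs →
    ∑ (λ i → sum (map (F i) xs)) ≡ sum (map (λ x → ∑ (λ i → F i x)) xs)
  ∑-sum-map {m} F List.[] = sum-replicate-zero m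
  ∑-sum-map F (x List.∷ xs) =
    trans (∑-distrib-+ (λ i → F i x) _) (cong (∑ (λ i → F i x) +_) (∑-sum-map F xs))

  sum-map-filter : ∀ {P : A → Set} (P? : Decidable P) (f : A → ℕ) xs →
    sum (map f (filter P? xs)) ≡ sum (map (λ x → [ does (P? x) ] * f x) xs)
  sum-map-filter P? f List.[] = refl
  sum-map-filter P? f (x List.∷ xs) with does (P? x)
  ... | true = cong₂ _+_ (sym (+-identityʳ (f x))) (sum-map-filter P? f xs)
  ... | false = sum-map-filter P? f xs

  sum-map-concatMap : ∀ {B : Set} (f : B → ℕ) (g : A → List B) xs →
    sum (map f (List.concatMap g xs)) ≡ sum (map (λ x → sum (map f (g x))) xs)
  sum-map-concatMap f g List.[] = refl
  sum-map-concatMap f g (x List.∷ xs) = begin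
    sum (map f (g x List.++ List.concatMap g xs))
      ≡⟨ cong sum (map-++ f (g x) _) ⟩
    sum (map f (g x) List.++ map f (List.concatMap g xs))
      ≡⟨ sum-++ (map f (g x)) _ ⟩
    sum (map f (g x)) + sum (map f (List.concatMap g xs))
      ≡⟨ cong (sum (map f (g x)) +_) (sum-map-concatMap f g xs) ⟩
    sum (map f (g x)) + sum (map (λ y → sum (map f (g y))) xs) ∎
    where open ≡-Reasoning

sum-map-tabulate : ∀ {A : Set} m (g : Fin m → A) (f : A → ℕ) →
  sum (map f (List.tabulate g)) ≡ ∑ (f ∘ g)
sum-map-tabulate zero g f = refl
sum-map-tabulate (suc m) g f = cong (f (g Fin.zero) +_) (sum-map-tabulate m (g ∘ Fin.suc) f)

-- Independent sets

∣∣≡∑ : ∀ {m} (S : Subset m) → ∣ S ∣ ≡ ∑ (λ i → [ lookup S i ])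
∣∣≡∑ [] = refl
∣∣≡∑ (true ∷ S) = cong suc (∣∣≡∑ S)
∣∣≡∑ (false ∷ S) = ∣∣≡∑ S

∈-tabulate⁻ : ∀ {m} (f : Fin m → Bool) {i} → i ∈ tabulate f → f i ≡ true
∈-tabulate⁻ f {i} i∈ = trans (sym (lookup∘tabulate f i)) ([]=⇒lookup i∈)

does-∈? : ∀ {m} (x : Fin m) S → does (x ∈? S) ≡ lookup S x
does-∈? x S with lookup S x in Sx
... | true = dec-true (x ∈? S) (lookup⇒[]= x S Sx)
... | false = dec-false (x ∈? S) λ x∈S → contradiction (trans (sym ([]=⇒lookup x∈S)) Sx) λ ()

tabulate-independent : ∀ G (f : Fin (n G) → Bool) →
  (∀ i j → f i ≡ true → f j ≡ true → adj G i j ≡ false) → Independent G (tabulate f)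
tabulate-independent G f indep i j i∈ j∈ = indep i j (∈-tabulate⁻ f i∈) (∈-tabulate⁻ f j∈)

∈-allSubsets : ∀ k (S : Subset k) → S ∈ᴸ allSubsets k
∈-allSubsets zero [] = here refl
∈-allSubsets (suc k) (true ∷ S) = ∈-++⁺ˡ (∈-map⁺ (true ∷_) (∈-allSubsets k S))
∈-allSubsets (suc k) (false ∷ S) = ∈-++⁺ʳ _ (∈-map⁺ (false ∷_) (∈-allSubsets k S))

∣∣≤α : ∀ G S → Independent G S → ∣ S ∣ ≤ α G
∣∣≤α G S indep = foldr-preservesᵒ ≤⊔ 0 _
  (inj₂ (lose (∈-map⁺ ∣_∣ (∈-filter⁺ (independent? G) (∈-allSubsets (n G) S) indep)) ≤-refl))
  where
  ≤⊔ : ∀ x y → ∣ S ∣ ≤ x ⊎ ∣ S ∣ ≤ y → ∣ S ∣ ≤ x ⊔ y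
  ≤⊔ x y (inj₁ ≤x) = m≤n⇒m≤n⊔o y ≤x
  ≤⊔ x y (inj₂ ≤y) = m≤n⇒m≤o⊔n x ≤y

α-attained : ∀ G → ∃ λ S → Independent G S × ∣ S ∣ ≡ α G
α-attained G with foldr-selective ⊔-sel 0 (List.map ∣_∣ (List.filter (independent? G) (allSubsets (n G))))
... | inj₁ α≡0 = ⊥ , (λ i j i∈ → ⊥-elim (∉⊥ i∈)) , trans (∣⊥∣≡0 (n G)) (sym α≡0)
... | inj₂ α∈ with ∈-map⁻ ∣_∣ α∈
... | S , S∈ , α≡∣S∣ = S , proj₂ (∈-filter⁻ (independent? G) {xs = allSubsets (n G)} S∈) , sym α≡∣S∣

image : ∀ {m k} → (Fin m → Fin k) → Subset m → Subset k
image f S = tabulate (λ y → any (λ x → ⌊ f x ≟ y ⌋ ∧ lookup S x))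

∑-preimage≤image : ∀ {m k} (f : Fin m → Fin k) → Injective _≡_ _≡_ f → ∀ S y →
  ∑ (λ x → [ ⌊ f x ≟ y ⌋ ] * [ lookup S x ]) ≤ [ lookup (image f S) y ]
∑-preimage≤image {m} f f-inj S y = begin
  ∑[ x < m ] ([ ⌊ f x ≟ y ⌋ ] * [ lookup S x ]) ≡⟨ sum-cong-≗ (λ x → [∧] ⌊ f x ≟ y ⌋ (lookup S x)) ⟨
  ∑[ x < m ] [ ⌊ f x ≟ y ⌋ ∧ lookup S x ]       ≤⟨ ∑[]≤[any] _ unique ⟩
  [ any (λ x → ⌊ f x ≟ y ⌋ ∧ lookup S x ) ]     ≡⟨ cong [_] (lookup∘tabulate _ y) ⟨
  [ lookup (image f S) y ] ∎
  where
  open ≤-Reasoning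
  unique : ∀ x x′ → (⌊ f x ≟ y ⌋ ∧ lookup S x) ≡ true → (⌊ f x′ ≟ y ⌋ ∧ lookup S x′) ≡ true → x ≡ x′
  unique x x′ e e′ = f-inj (trans (⌊⌋-true⁻ (f x ≟ y) (∧-conicalˡ _ _ e))
                                  (sym (⌊⌋-true⁻ (f x′ ≟ y) (∧-conicalˡ _ _ e′))))

∣∣≤∣image∣ : ∀ {m k} (f : Fin m → Fin k) → Injective _≡_ _≡_ f → ∀ S → ∣ S ∣ ≤ ∣ image f S ∣
∣∣≤∣image∣ {m} {k} f f-inj S = begin
  ∣ S ∣
    ≡⟨ ∣∣≡∑ S ⟩
  ∑[ x < m ] [ lookup S x ]
    ≡⟨ sum-cong-≗ (λ x → ∑-δ (f x) (λ _ → [ lookup S x ])) ⟨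
  ∑[ x < m ] ∑[ y < k ] ([ ⌊ f x ≟ y ⌋ ] * [ lookup S x ])
    ≡⟨ ∑-comm (λ x y → [ ⌊ f x ≟ y ⌋ ] * [ lookup S x ]) ⟩
  ∑[ y < k ] ∑[ x < m ] ([ ⌊ f x ≟ y ⌋ ] * [ lookup S x ])
    ≤⟨ ∑-mono (∑-preimage≤image f f-inj S) ⟩
  ∑[ y < k ] [ lookup (image f S) y ]
    ≡⟨ ∣∣≡∑ (image f S) ⟨
  ∣ image f S ∣ ∎
  where open ≤-Reasoning

image-independent : ∀ A B (f : Fin (n A) → Fin (n B)) →
  (∀ x x′ → adj A x x′ ≡ false → adj B (f x) (f x′) ≡ false) →
  ∀ S → Independent A S → Independent B (image f S)
image-independent A B f pres S indep = tabulate-independent B _ λ y y′ e e′ →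
  let x , ex = any-witness _ e
      x′ , ex′ = any-witness _ e′
  in subst₂ (λ u v → adj B u v ≡ false)
       (⌊⌋-true⁻ (f x ≟ y) (∧-conicalˡ _ _ ex)) (⌊⌋-true⁻ (f x′ ≟ y′) (∧-conicalˡ _ _ ex′))
       (pres x x′ (indep x x′ (lookup⇒[]= x S (∧-conicalʳ _ _ ex)) (lookup⇒[]= x′ S (∧-conicalʳ _ _ ex′))))

α-mono : ∀ A B (f : Fin (n A) → Fin (n B)) → Injective _≡_ _≡_ f →
  (∀ x x′ → adj A x x′ ≡ false → adj B (f x) (f x′) ≡ false) → α A ≤ α B
α-mono A B f f-inj pres with α-attained A
... | S , S-indep , ∣S∣≡α = begin
  α A           ≡⟨ ∣S∣≡α ⟨
  ∣ S ∣         ≤⟨ ∣∣≤∣image∣ f f-inj S ⟩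
  ∣ image f S ∣ ≤⟨ ∣∣≤α B (image f S) (image-independent A B f pres S S-indep) ⟩
  α B ∎
  where open ≤-Reasoning

discrete : ℕ → Graph
discrete m = graph m (λ _ _ → false)

≤α-by-injection : ∀ {m} B (f : Fin m → Fin (n B)) → Injective _≡_ _≡_ f →
  (∀ x x′ → adj B (f x) (f x′) ≡ false) → m ≤ α B
≤α-by-injection {m} B f f-inj indep = begin
  m                   ≡⟨ ∣⊤∣≡n m ⟨
  ∣ ⊤ {m} ∣           ≤⟨ ∣∣≤α (discrete m) ⊤ (λ _ _ _ _ → refl) ⟩
  α (discrete m)      ≤⟨ α-mono (discrete m) B f f-inj (λ x x′ _ → indep x x′) ⟩
  α B ∎
  where open ≤-Reasoning

-- Strong products and complements

data NonAdj⊠ (A B : Graph) (p q : Fin (n A) × Fin (n B)) : Set where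
  same   : p ≡ q → NonAdj⊠ A B p q
  apartˡ : proj₁ p ≢ proj₁ q → adj A (proj₁ p) (proj₁ q) ≡ false → NonAdj⊠ A B p q
  apartʳ : proj₂ p ≢ proj₂ q → adj B (proj₂ p) (proj₂ q) ≡ false → NonAdj⊠ A B p q

remQuot-injective : ∀ {m} k {x y : Fin (m * k)} → remQuot {m} k x ≡ remQuot k y → x ≡ y
remQuot-injective {m} k {x} {y} e =
  trans (sym (combine-remQuot {m} k x)) (trans (cong (uncurry combine) e) (combine-remQuot {m} k y))

⊠-irreflexive : ∀ A B x → adj (A ⊠ B) x x ≡ false
⊠-irreflexive A B x rewrite ⌊⌋-true (x ≟ x) refl = refl

⊠-nonadj⁺ : ∀ A B x y → NonAdj⊠ A B (remQuot (n B) x) (remQuot (n B) y) → adj (A ⊠ B) x y ≡ false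
⊠-nonadj⁺ A B x y (same e) =
  subst (λ y → adj (A ⊠ B) x y ≡ false) (remQuot-injective (n B) e) (⊠-irreflexive A B x)
⊠-nonadj⁺ A B x y (apartˡ a≢a′ ¬adj) rewrite ⌊⌋-false (proj₁ (remQuot (n B) x) ≟ _) a≢a′ | ¬adj = ∧-zeroʳ _
⊠-nonadj⁺ A B x y (apartʳ b≢b′ ¬adj) =
  trans (cong (λ z → not ⌊ x ≟ y ⌋ ∧ (adjˡ ∧ z)) (cong₂ _∨_ (⌊⌋-false (_ ≟ _) b≢b′) ¬adj))
        (trans (cong (not ⌊ x ≟ y ⌋ ∧_) (∧-zeroʳ adjˡ)) (∧-zeroʳ _))
  where
  a = proj₁ (remQuot {n A} (n B) x)
  a′ = proj₁ (remQuot {n A} (n B) y)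
  adjˡ = ⌊ a ≟ a′ ⌋ ∨ adj A a a′

⊠-nonadj⁻ : ∀ A B x y → adj (A ⊠ B) x y ≡ false → NonAdj⊠ A B (remQuot (n B) x) (remQuot (n B) y)
⊠-nonadj⁻ A B x y ¬adj with x ≟ y
... | yes refl = same refl
... | no _ with ∧-false-split _ _ ¬adj
...   | inj₁ ¬adjˡ = apartˡ (⌊⌋-false⁻ (_ ≟ _) (∨-conicalˡ _ _ ¬adjˡ)) (∨-conicalʳ _ _ ¬adjˡ)
...   | inj₂ ¬adjʳ = apartʳ (⌊⌋-false⁻ (_ ≟ _) (∨-conicalˡ _ _ ¬adjʳ)) (∨-conicalʳ _ _ ¬adjʳ)

⊠-independent⁻ : ∀ A B S → Independent (A ⊠ B) S → ∀ {a b a′ b′} →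
  lookup S (combine a b) ≡ true → lookup S (combine a′ b′) ≡ true → NonAdj⊠ A B (a , b) (a′ , b′)
⊠-independent⁻ A B S indep {a} {b} {a′} {b′} ab∈ a′b′∈ =
  subst₂ (NonAdj⊠ A B) (remQuot-combine a b) (remQuot-combine a′ b′)
    (⊠-nonadj⁻ A B _ _ (indep _ _ (lookup⇒[]= _ S ab∈) (lookup⇒[]= _ S a′b′∈)))

⊠-nonadj⁺-combine : ∀ A B {a b a′ b′} → NonAdj⊠ A B (a , b) (a′ , b′) →
  adj (A ⊠ B) (combine a b) (combine a′ b′) ≡ false
⊠-nonadj⁺-combine A B {a} {b} {a′} {b′} =
  ⊠-nonadj⁺ A B _ _ ∘ subst₂ (NonAdj⊠ A B) (sym (remQuot-combine a b)) (sym (remQuot-combine a′ b′))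

⊠-tabulate : ∀ {m k} → (Fin m → Fin k → Bool) → Subset (m * k)
⊠-tabulate {m} {k} f = tabulate (λ x → uncurry f (remQuot {m} k x))

⊠-tabulate-independent : ∀ A B (f : Fin (n A) → Fin (n B) → Bool) →
  (∀ a b a′ b′ → f a b ≡ true → f a′ b′ ≡ true → NonAdj⊠ A B (a , b) (a′ , b′)) →
  Independent (A ⊠ B) (⊠-tabulate f)
⊠-tabulate-independent A B f nonadj = tabulate-independent (A ⊠ B) _
  λ x y fx fy → ⊠-nonadj⁺ A B x y (nonadj _ _ _ _ fx fy)

∣∣≡∑∑ : ∀ {m k} (S : Subset (m * k)) → ∣ S ∣ ≡ ∑[ a < m ] ∑[ b < k ] [ lookup S (combine a b) ]
∣∣≡∑∑ {m} S = trans (∣∣≡∑ S) (∑-combine m (λ x → [ lookup S x ]))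

∣⊠-tabulate∣ : ∀ {m k} (f : Fin m → Fin k → Bool) → ∣ ⊠-tabulate f ∣ ≡ ∑[ a < m ] ∑[ b < k ] [ f a b ]
∣⊠-tabulate∣ {m} {k} f = trans (∣∣≡∑∑ {m} {k} (⊠-tabulate f)) (sum-cong-≗ λ a → sum-cong-≗ λ b →
  cong [_] (trans (lookup∘tabulate (λ x → uncurry f (remQuot {m} k x)) (combine a b))
                  (cong (uncurry f) (remQuot-combine a b))))

⊠-swap : ∀ {m k} → Fin (m * k) → Fin (k * m)
⊠-swap {m} {k} x = let a , b = remQuot {m} k x in combine b a

⊠-swap-injective : ∀ {m k} → Injective _≡_ _≡_ (⊠-swap {m} {k})
⊠-swap-injective {m} {k} {x} {y} e =
  remQuot-injective k (cong swap (trans (sym (remQuot-combine _ _))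
                                       (trans (cong (remQuot m) e) (remQuot-combine _ _))))

α-⊠-comm : ∀ A B → α (A ⊠ B) ≤ α (B ⊠ A)
α-⊠-comm A B = α-mono (A ⊠ B) (B ⊠ A) (⊠-swap {n A}) (⊠-swap-injective {n A}) λ x y ¬adj →
  ⊠-nonadj⁺-combine B A (nonadj-swap (⊠-nonadj⁻ A B x y ¬adj))
  where
  nonadj-swap : ∀ {p q} → NonAdj⊠ A B p q → NonAdj⊠ B A (swap p) (swap q)
  nonadj-swap (same p≡q) = same (cong swap p≡q)
  nonadj-swap (apartˡ a≢a′ ¬adj) = apartʳ a≢a′ ¬adj
  nonadj-swap (apartʳ b≢b′ ¬adj) = apartˡ b≢b′ ¬adj

ᶜ-simple : ∀ G → IsSimple G → IsSimple (G ᶜ)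
ᶜ-simple G (symmetric , _) = (λ i j → cong₂ (λ a b → not a ∧ not b) (symmetric i j) (≟-sym i j)) ,
  (λ i → trans (cong (λ b → not (adj G i i) ∧ not b) (⌊⌋-true (i ≟ i) refl)) (∧-zeroʳ _))
  where
  ≟-sym : ∀ i j → ⌊ i ≟ j ⌋ ≡ ⌊ j ≟ i ⌋
  ≟-sym i j with i ≟ j
  ... | yes refl = sym (⌊⌋-true (i ≟ i) refl)
  ... | no i≢j = sym (⌊⌋-false (j ≟ i) (i≢j ∘ sym))

ᶜᶜ-adj : ∀ H → IsSimple H → ∀ i j → adj (H ᶜ ᶜ) i j ≡ adj H i j
ᶜᶜ-adj H (_ , loopless) i j with i ≟ j
... | yes refl = trans (∧-zeroʳ _) (sym (loopless i))
... | no _ with adj H i j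
... | true = refl
... | false = refl

α-⊠-ᶜᶜ : ∀ H X → IsSimple H → α (H ⊠ X) ≤ α (H ᶜ ᶜ ⊠ X)
α-⊠-ᶜᶜ H X simple = α-mono (H ⊠ X) (H ᶜ ᶜ ⊠ X) id id λ x y ¬adj →
  ⊠-nonadj⁺ (H ᶜ ᶜ) X x y (ᶜᶜ-nonadj (⊠-nonadj⁻ H X x y ¬adj))
  where
  ᶜᶜ-nonadj : ∀ {p q} → NonAdj⊠ H X p q → NonAdj⊠ (H ᶜ ᶜ) X p q
  ᶜᶜ-nonadj (same p≡q) = same p≡q
  ᶜᶜ-nonadj (apartˡ a≢a′ ¬adj) = apartˡ a≢a′ (trans (ᶜᶜ-adj H simple _ _) ¬adj)
  ᶜᶜ-nonadj (apartʳ b≢b′ ¬adj) = apartʳ b≢b′ ¬adj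

∣V∣≤α-⊠ᶜ : ∀ G → ∣V∣ G ≤ α (G ⊠ G ᶜ)
∣V∣≤α-⊠ᶜ G = ≤α-by-injection (G ⊠ G ᶜ) (λ g → combine g g)
  (λ e → proj₁ (combine-injective _ _ _ _ e)) (λ g g′ → ⊠-nonadj⁺-combine G (G ᶜ) (diagonal g g′))
  where
  diagonal : ∀ g g′ → NonAdj⊠ G (G ᶜ) (g , g) (g′ , g′)
  diagonal g g′ with g ≟ g′ | adj G g g′ in adj-gg′
  ... | yes refl | _ = same refl
  ... | no g≢g′ | false = apartˡ g≢g′ adj-gg′
  ... | no g≢g′ | true = apartʳ g≢g′ (cong (λ b → not b ∧ not ⌊ g ≟ g′ ⌋) adj-gg′)

1≤α-⊠ : ∀ A B → 1 ≤ ∣V∣ A → 1 ≤ ∣V∣ B → 1 ≤ α (A ⊠ B)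
1≤α-⊠ A B 1≤∣A∣ 1≤∣B∣ = ≤α-by-injection (A ⊠ B) (λ _ → x₀) (λ { {Fin.zero} {Fin.zero} _ → refl })
  (λ _ _ → ⊠-irreflexive A B x₀)
  where
  x₀ = combine (Fin.fromℕ< 1≤∣A∣) (Fin.fromℕ< 1≤∣B∣)

-- Automorphisms

⟨$⟩ʳ-injective : ∀ {m} (σ : Permutation′ m) → Injective _≡_ _≡_ (σ ⟨$⟩ʳ_)
⟨$⟩ʳ-injective σ = Injection.injective (↔⇒↣ σ)

⌊≟⌋-injective : ∀ {m k} (f : Fin m → Fin k) → Injective _≡_ _≡_ f → ∀ x y → ⌊ f x ≟ f y ⌋ ≡ ⌊ x ≟ y ⌋
⌊≟⌋-injective f f-inj x y with x ≟ y
... | yes refl = ⌊⌋-true (f x ≟ f x) refl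
... | no x≢y = ⌊⌋-false (f x ≟ f y) (x≢y ∘ f-inj)

ᶜ-isAutomorphism : ∀ G σ → IsAutomorphism G σ → IsAutomorphism (G ᶜ) σ
ᶜ-isAutomorphism G σ σ-aut i j =
  cong₂ (λ a b → not a ∧ not b) (σ-aut i j) (⌊≟⌋-injective _ (⟨$⟩ʳ-injective σ) i j)

ᶜ-vertexTransitive : ∀ G → VertexTransitive G → VertexTransitive (G ᶜ)
ᶜ-vertexTransitive G vt u v = let σ , σ-aut , σu≡v = vt u v in σ , ᶜ-isAutomorphism G σ σ-aut , σu≡v

_⊠ₚ_ : ∀ {m k} → Permutation′ m → Permutation′ k → Permutation′ (m * k)
σ ⊠ₚ τ = ↔-trans *↔× (↔-trans (σ ×-↔ τ) (↔-sym *↔×))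

linked : (A : Graph) → Fin (n A) → Fin (n A) → Bool
linked A a a′ = ⌊ a ≟ a′ ⌋ ∨ adj A a a′

⊠-isAutomorphism : ∀ A B σ τ → IsAutomorphism A σ → IsAutomorphism B τ → IsAutomorphism (A ⊠ B) (σ ⊠ₚ τ)
⊠-isAutomorphism A B σ τ σ-aut τ-aut x y = begin
  adj (A ⊠ B) (π ⟨$⟩ʳ x) (π ⟨$⟩ʳ y)
    ≡⟨ cong₂ (λ p q → not ⌊ π ⟨$⟩ʳ x ≟ π ⟨$⟩ʳ y ⌋
                      ∧ (linked A (proj₁ p) (proj₁ q) ∧ linked B (proj₂ p) (proj₂ q)))
             (remQuot-combine _ _) (remQuot-combine _ _) ⟩
  not ⌊ π ⟨$⟩ʳ x ≟ π ⟨$⟩ʳ y ⌋ ∧ (linked A (σ ⟨$⟩ʳ a) (σ ⟨$⟩ʳ a′) ∧ linked B (τ ⟨$⟩ʳ b) (τ ⟨$⟩ʳ b′))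
    ≡⟨ cong₂ (λ e l → not e ∧ l) (⌊≟⌋-injective _ (⟨$⟩ʳ-injective π) x y)
             (cong₂ _∧_ (linked-preserved A σ σ-aut a a′) (linked-preserved B τ τ-aut b b′)) ⟩
  adj (A ⊠ B) x y ∎
  where
  open ≡-Reasoning
  π = σ ⊠ₚ τ
  a = proj₁ (remQuot {n A} (n B) x)
  b = proj₂ (remQuot {n A} (n B) x)
  a′ = proj₁ (remQuot {n A} (n B) y)
  b′ = proj₂ (remQuot {n A} (n B) y)
  linked-preserved : ∀ C ρ → IsAutomorphism C ρ → ∀ c c′ → linked C (ρ ⟨$⟩ʳ c) (ρ ⟨$⟩ʳ c′) ≡ linked C c c′
  linked-preserved C ρ ρ-aut c c′ = cong₂ _∨_ (⌊≟⌋-injective _ (⟨$⟩ʳ-injective ρ) c c′) (ρ-aut c c′)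

⊠-vertexTransitive : ∀ A B → VertexTransitive A → VertexTransitive B → VertexTransitive (A ⊠ B)
⊠-vertexTransitive A B vtA vtB x y =
  let σ , σ-aut , σa≡a′ = vtA (proj₁ (remQuot {n A} (n B) x)) (proj₁ (remQuot {n A} (n B) y))
      τ , τ-aut , τb≡b′ = vtB (proj₂ (remQuot {n A} (n B) x)) (proj₂ (remQuot {n A} (n B) y))
  in σ ⊠ₚ τ , ⊠-isAutomorphism A B σ τ σ-aut τ-aut ,
     trans (cong₂ combine σa≡a′ τb≡b′) (combine-remQuot {n A} (n B) y)

-- Counting automorphisms

vectors : ∀ m k → List (Vec (Fin m) k)
vectors m zero = [] List.∷ List.[]
vectors m (suc k) = List.concatMap (λ a → map (a ∷_) (vectors m k)) (List.allFin m)

sum-map-vectors : ∀ m k (F : Vec (Fin m) (suc k) → ℕ) →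
  sum (map F (vectors m (suc k))) ≡ ∑[ a < m ] sum (map (F ∘ (a ∷_)) (vectors m k))
sum-map-vectors m k F = begin
  sum (map F (vectors m (suc k)))
    ≡⟨ sum-map-concatMap F _ (List.allFin m) ⟩
  sum (map (λ a → sum (map F (map (a ∷_) (vectors m k)))) (List.allFin m))
    ≡⟨ cong sum (map-cong (λ a → cong sum (sym (map-∘ (vectors m k)))) (List.allFin m)) ⟩
  sum (map (λ a → sum (map (F ∘ (a ∷_)) (vectors m k))) (List.allFin m))
    ≡⟨ sum-map-tabulate m id _ ⟩
  ∑[ a < m ] sum (map (F ∘ (a ∷_)) (vectors m k)) ∎
  where open ≡-Reasoning

sum-map-vectors-permute : ∀ {m} (π : Permutation′ m) k (F : Vec (Fin m) k → ℕ) →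
  sum (map F (vectors m k)) ≡ sum (map (F ∘ Vec.map (π ⟨$⟩ʳ_)) (vectors m k))
sum-map-vectors-permute π zero F = refl
sum-map-vectors-permute {m} π (suc k) F = begin
  sum (map F (vectors m (suc k)))
    ≡⟨ sum-map-vectors m k F ⟩
  ∑[ a < m ] sum (map (F ∘ (a ∷_)) (vectors m k))
    ≡⟨ ∑-permute _ π ⟩
  ∑[ a < m ] sum (map (F ∘ ((π ⟨$⟩ʳ a) ∷_)) (vectors m k))
    ≡⟨ sum-cong-≗ (λ a → sum-map-vectors-permute π k (F ∘ ((π ⟨$⟩ʳ a) ∷_))) ⟩
  ∑[ a < m ] sum (map (F ∘ Vec.map (π ⟨$⟩ʳ_) ∘ (a ∷_)) (vectors m k))
    ≡⟨ sum-map-vectors m k _ ⟨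
  sum (map (F ∘ Vec.map (π ⟨$⟩ʳ_)) (vectors m (suc k))) ∎
  where open ≡-Reasoning

term≤sum-map-vectors : ∀ {m} k (F : Vec (Fin m) k → ℕ) v → F v ≤ sum (map F (vectors m k))
term≤sum-map-vectors zero F [] = m≤m+n (F []) 0
term≤sum-map-vectors {m} (suc k) F (a ∷ v) = begin
  F (a ∷ v)                                        ≤⟨ term≤sum-map-vectors k (F ∘ (a ∷_)) v ⟩
  sum (map (F ∘ (a ∷_)) (vectors m k))             ≤⟨ term≤∑ (λ b → sum (map (F ∘ (b ∷_)) (vectors m k))) a ⟩
  ∑[ b < m ] sum (map (F ∘ (b ∷_)) (vectors m k))  ≡⟨ sum-map-vectors m k F ⟨
  sum (map F (vectors m (suc k))) ∎
  where open ≤-Reasoning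

-- Automorphisms are enumerated as vectors of images, so that sums over Aut K are finite list sums.
IsAutomorphismᵛ : (K : Graph) → Vec (Fin (n K)) (n K) → Set
IsAutomorphismᵛ K v =
  (∀ i j → lookup v i ≡ lookup v j → i ≡ j) × (∀ i j → adj K (lookup v i) (lookup v j) ≡ adj K i j)

isAutomorphismᵛ? : ∀ K → Decidable (IsAutomorphismᵛ K)
isAutomorphismᵛ? K v =
  (all? λ i → all? λ j → (lookup v i ≟ lookup v j) →-dec (i ≟ j)) ×-dec
  (all? λ i → all? λ j → adj K (lookup v i) (lookup v j) Bool.≟ adj K i j)

automorphisms : (K : Graph) → List (Vec (Fin (n K)) (n K))
automorphisms K = filter (isAutomorphismᵛ? K) (vectors (n K) (n K))

∑Aut : (K : Graph) → (Vec (Fin (n K)) (n K) → ℕ) → ℕ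
∑Aut K f = sum (map f (automorphisms K))

#Aut : Graph → ℕ
#Aut K = ∑Aut K (λ _ → 1)

∑Aut-via-vectors : ∀ K f →
  ∑Aut K f ≡ sum (map (λ v → [ does (isAutomorphismᵛ? K v) ] * f v) (vectors (n K) (n K)))
∑Aut-via-vectors K f = sum-map-filter (isAutomorphismᵛ? K) f (vectors (n K) (n K))

∑Aut-const : ∀ K c → ∑Aut K (λ _ → c) ≡ c * #Aut K
∑Aut-const K c =
  trans (cong sum (map-cong (λ _ → sym (*-identityʳ c)) (automorphisms K)))
        (sym (sum-map-*ˡ c _ (automorphisms K)))

∑Aut-mono : ∀ K {f g} → (∀ v → IsAutomorphismᵛ K v → f v ≤ g v) → ∑Aut K f ≤ ∑Aut K g
∑Aut-mono K = sum-map-mono (all-filter (isAutomorphismᵛ? K) (vectors (n K) (n K)))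

#Aut≥1 : ∀ K → 1 ≤ #Aut K
#Aut≥1 K = begin
  1
    ≡⟨ cong (λ b → [ b ] * 1) (dec-true (isAutomorphismᵛ? K ι) ι-aut) ⟨
  [ does (isAutomorphismᵛ? K ι) ] * 1
    ≤⟨ term≤sum-map-vectors (n K) _ ι ⟩
  sum (map (λ v → [ does (isAutomorphismᵛ? K v) ] * 1) (vectors (n K) (n K)))
    ≡⟨ ∑Aut-via-vectors K (λ _ → 1) ⟨
  #Aut K ∎
  where
  open ≤-Reasoning
  ι = Vec.allFin (n K)
  ι-aut : IsAutomorphismᵛ K ι
  ι-aut = (λ i j e → trans (sym (lookup-allFin i)) (trans e (lookup-allFin j))) ,
          (λ i j → cong₂ (adj K) (lookup-allFin i) (lookup-allFin j))

cancel-#Aut : ∀ K {x y} → #Aut K * x ≤ #Aut K * y → x ≤ y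
cancel-#Aut K = *-cancelˡ-≤ (#Aut K) {{>-nonZero (#Aut≥1 K)}}

-- Left translation by an automorphism τ permutes Aut K.
module _ (K : Graph) (τ : Permutation′ (n K)) (τ-aut : IsAutomorphism K τ) where

  private
    τ∘ : Vec (Fin (n K)) (n K) → Vec (Fin (n K)) (n K)
    τ∘ = Vec.map (τ ⟨$⟩ʳ_)

  lookup-τ∘ : ∀ v i → lookup (τ∘ v) i ≡ τ ⟨$⟩ʳ lookup v i
  lookup-τ∘ v i = lookup-map i (τ ⟨$⟩ʳ_) v

  isAutomorphismᵛ-τ∘ : ∀ v → IsAutomorphismᵛ K (τ∘ v) ⇔ IsAutomorphismᵛ K v
  isAutomorphismᵛ-τ∘ v = mk⇔
    (λ (inj , pres) →
       (λ i j e → inj i j (trans (lookup-τ∘ v i) (trans (cong (τ ⟨$⟩ʳ_) e) (sym (lookup-τ∘ v j))))) ,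
       (λ i j → trans (sym (τ-aut _ _))
                      (trans (sym (cong₂ (adj K) (lookup-τ∘ v i) (lookup-τ∘ v j))) (pres i j))))
    (λ (inj , pres) →
       (λ i j e → inj i j (⟨$⟩ʳ-injective τ (trans (sym (lookup-τ∘ v i)) (trans e (lookup-τ∘ v j))))) ,
       (λ i j → trans (cong₂ (adj K) (lookup-τ∘ v i) (lookup-τ∘ v j)) (trans (τ-aut _ _) (pres i j))))

  ∑Aut-τ∘ : ∀ f → ∑Aut K (f ∘ τ∘) ≡ ∑Aut K f
  ∑Aut-τ∘ f = begin
    ∑Aut K (f ∘ τ∘)
      ≡⟨ ∑Aut-via-vectors K (f ∘ τ∘) ⟩
    sum (map (λ v → [ does (isAutomorphismᵛ? K v) ] * f (τ∘ v)) (vectors (n K) (n K)))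
      ≡⟨ cong sum (map-cong (λ v → cong (λ b → [ b ] * f (τ∘ v))
           (does-⇔ (isAutomorphismᵛ-τ∘ v) (isAutomorphismᵛ? K (τ∘ v)) (isAutomorphismᵛ? K v)))
         (vectors (n K) (n K))) ⟨
    sum (map (λ v → [ does (isAutomorphismᵛ? K (τ∘ v)) ] * f (τ∘ v)) (vectors (n K) (n K)))
      ≡⟨ sum-map-vectors-permute τ (n K) _ ⟨
    sum (map (λ v → [ does (isAutomorphismᵛ? K v) ] * f v) (vectors (n K) (n K)))
      ≡⟨ ∑Aut-via-vectors K f ⟨
    ∑Aut K f ∎
    where open ≡-Reasoning

#Maps : (K : Graph) → Fin (n K) → Fin (n K) → ℕ
#Maps K g g′ = ∑Aut K (λ v → [ ⌊ lookup v g ≟ g′ ⌋ ])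

∑-#Maps : ∀ K g → ∑[ g′ < n K ] #Maps K g g′ ≡ #Aut K
∑-#Maps K g = trans (∑-sum-map (λ g′ v → [ ⌊ lookup v g ≟ g′ ⌋ ]) (automorphisms K))
  (cong sum (map-cong (λ v → trans (sum-cong-≗ (λ g′ → sym (*-identityʳ [ ⌊ lookup v g ≟ g′ ⌋ ])))
                                   (∑-δ (lookup v g) (λ _ → 1)))
                      (automorphisms K)))

#Maps-τ : ∀ K τ → IsAutomorphism K τ → ∀ g g′ → #Maps K g (τ ⟨$⟩ʳ g′) ≡ #Maps K g g′
#Maps-τ K τ τ-aut g g′ = trans (sym (∑Aut-τ∘ K τ τ-aut _))
  (cong sum (map-cong (λ v → cong [_] (trans (cong (λ z → ⌊ z ≟ τ ⟨$⟩ʳ g′ ⌋) (lookup-τ∘ K τ τ-aut v g))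
                                             (⌊≟⌋-injective _ (⟨$⟩ʳ-injective τ) _ _)))
                      (automorphisms K)))

-- #Maps K g g′ does not depend on g′ by transitivity, and summing it over g′ counts every
-- automorphism once.
n*#Maps≡#Aut : ∀ K → VertexTransitive K → ∀ g g′ → n K * #Maps K g g′ ≡ #Aut K
n*#Maps≡#Aut K vt g g′ = begin
  n K * #Maps K g g′           ≡⟨ ∑-const (n K) _ ⟨
  ∑[ g″ < n K ] #Maps K g g′   ≡⟨ sum-cong-≗ #Maps-uniform ⟩
  ∑[ g″ < n K ] #Maps K g g″   ≡⟨ ∑-#Maps K g ⟩
  #Aut K ∎
  where
  open ≡-Reasoning
  #Maps-uniform : ∀ g″ → #Maps K g g′ ≡ #Maps K g g″
  #Maps-uniform g″ = let σ , σ-aut , σg′≡g″ = vt g′ g″ in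
    trans (sym (#Maps-τ K σ σ-aut g g′)) (cong (#Maps K g) σg′≡g″)

∑Aut-average : ∀ K → VertexTransitive K → ∀ g (t : Fin (n K) → ℕ) →
  n K * ∑Aut K (λ v → t (lookup v g)) ≡ #Aut K * ∑ t
∑Aut-average K vt g t = begin
  n K * ∑Aut K (λ v → t (lookup v g))
    ≡⟨ cong (λ f → n K * sum f) (map-cong (λ v → ∑-δ (lookup v g) t) (automorphisms K)) ⟨
  n K * ∑Aut K (λ v → ∑[ g′ < n K ] ([ ⌊ lookup v g ≟ g′ ⌋ ] * t g′))
    ≡⟨ cong (n K *_) (∑-sum-map (λ g′ v → [ ⌊ lookup v g ≟ g′ ⌋ ] * t g′) (automorphisms K)) ⟨
  n K * (∑[ g′ < n K ] ∑Aut K (λ v → [ ⌊ lookup v g ≟ g′ ⌋ ] * t g′))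
    ≡⟨ cong (n K *_) (sum-cong-≗ #Maps*t) ⟩
  n K * (∑[ g′ < n K ] (t g′ * #Maps K g g′))
    ≡⟨ *-distribˡ-sum (n K) (λ g′ → t g′ * #Maps K g g′) ⟩
  ∑[ g′ < n K ] (n K * (t g′ * #Maps K g g′))
    ≡⟨ sum-cong-≗ (λ g′ → trans (x*[y*z]≡y*[x*z] (n K) (t g′) _) (cong (t g′ *_) (n*#Maps≡#Aut K vt g g′))) ⟩
  ∑[ g′ < n K ] (t g′ * #Aut K)
    ≡⟨ *-distribʳ-sum (#Aut K) t ⟨
  ∑ t * #Aut K
    ≡⟨ *-comm (∑ t) (#Aut K) ⟩
  #Aut K * ∑ t ∎
  where
  open ≡-Reasoning
  #Maps*t : ∀ g′ → ∑Aut K (λ v → [ ⌊ lookup v g ≟ g′ ⌋ ] * t g′) ≡ t g′ * #Maps K g g′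
  #Maps*t g′ = trans (cong sum (map-cong (λ v → *-comm _ (t g′)) (automorphisms K)))
                     (sym (sum-map-*ˡ (t g′) _ (automorphisms K)))

-- The transfer inequality

module Transfer (G H W : Graph) (G-vt : VertexTransitive G)
                (S : Subset (n G * n W)) (S-indep : Independent (G ⊠ W) S)
                (T : Subset (n G * n H)) (T-indep : Independent (G ᶜ ⊠ H) T) where

  s : Fin (n G) → Fin (n W) → Bool
  s g w = lookup S (combine g w)

  t : Fin (n G) → Fin (n H) → Bool
  t g h = lookup T (combine g h)

  S-row : Fin (n G) → ℕ
  S-row g = ∑[ w < n W ] [ s g w ]

  T-row : Fin (n G) → ℕ
  T-row g = ∑[ h < n H ] [ t g h ]

  link : Vec (Fin (n G)) (n G) → Fin (n H) → Fin (n W) → Fin (n G) → Bool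
  link v h w g = s g w ∧ t (lookup v g) h

  transfer : Vec (Fin (n G)) (n G) → Subset (n H * n W)
  transfer v = ⊠-tabulate (λ h w → any (link v h w))

  module _ (v : Vec (Fin (n G)) (n G)) (v-aut : IsAutomorphismᵛ G v) where

    nonadjacent-in-G-and-Gᶜ : ∀ {g g′} →
      adj G g g′ ≡ false → adj (G ᶜ) (lookup v g) (lookup v g′) ≡ false → g ≡ g′
    nonadjacent-in-G-and-Gᶜ {g} {g′} ¬adj ¬adjᶜ with g ≟ g′
    ... | yes g≡g′ = g≡g′
    ... | no g≢g′ = contradiction (trans (sym adjᶜ≡true) ¬adjᶜ) λ ()
      where
      adjᶜ≡true : adj (G ᶜ) (lookup v g) (lookup v g′) ≡ true
      adjᶜ≡true = cong₂ (λ a b → not a ∧ not b) (trans (proj₂ v-aut g g′) ¬adj)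
                        (⌊⌋-false (_ ≟ _) (g≢g′ ∘ proj₁ v-aut g g′))

    transfer-nonadj : ∀ {g w g′ w′ h h′} → NonAdj⊠ G W (g , w) (g′ , w′) →
      NonAdj⊠ (G ᶜ) H (lookup v g , h) (lookup v g′ , h′) → NonAdj⊠ H W (h , w) (h′ , w′)
    transfer-nonadj (apartʳ w≢w′ ¬adj) _ = apartʳ w≢w′ ¬adj
    transfer-nonadj (same refl) (same e) = same (cong (λ p → proj₂ p , _) e)
    transfer-nonadj (same refl) (apartˡ vg≢vg _) = ⊥-elim (vg≢vg refl)
    transfer-nonadj (same refl) (apartʳ h≢h′ ¬adj) = apartˡ h≢h′ ¬adj
    transfer-nonadj (apartˡ g≢g′ _) (same e) = ⊥-elim (g≢g′ (proj₁ v-aut _ _ (cong proj₁ e)))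
    transfer-nonadj (apartˡ g≢g′ ¬adj) (apartˡ _ ¬adjᶜ) = ⊥-elim (g≢g′ (nonadjacent-in-G-and-Gᶜ ¬adj ¬adjᶜ))
    transfer-nonadj (apartˡ _ _) (apartʳ h≢h′ ¬adj) = apartˡ h≢h′ ¬adj

    transfer-witness-unique : ∀ h w g g′ → link v h w g ≡ true → link v h w g′ ≡ true → g ≡ g′
    transfer-witness-unique h w g g′ e e′
      with ⊠-independent⁻ G W S S-indep (∧-conicalˡ _ _ e) (∧-conicalˡ _ _ e′)
         | ⊠-independent⁻ (G ᶜ) H T T-indep (∧-conicalʳ _ _ e) (∧-conicalʳ _ _ e′)
    ... | same e | _ = cong proj₁ e
    ... | apartʳ w≢w _ | _ = ⊥-elim (w≢w refl)
    ... | apartˡ _ _ | same e = proj₁ v-aut _ _ (cong proj₁ e)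
    ... | apartˡ _ ¬adj | apartˡ _ ¬adjᶜ = nonadjacent-in-G-and-Gᶜ ¬adj ¬adjᶜ
    ... | apartˡ _ _ | apartʳ h≢h _ = ⊥-elim (h≢h refl)

    transfer-independent : Independent (H ⊠ W) (transfer v)
    transfer-independent = ⊠-tabulate-independent H W (λ h w → any (link v h w)) λ h w h′ w′ e e′ →
      let g , ge = any-witness (link v h w) e
          g′ , ge′ = any-witness (link v h′ w′) e′
      in transfer-nonadj (⊠-independent⁻ G W S S-indep (∧-conicalˡ _ _ ge) (∧-conicalˡ _ _ ge′))
                         (⊠-independent⁻ (G ᶜ) H T T-indep (∧-conicalʳ _ _ ge) (∧-conicalʳ _ _ ge′))

    ∑-rows≤∣transfer∣ : ∑[ g < n G ] (S-row g * T-row (lookup v g)) ≤ ∣ transfer v ∣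
    ∑-rows≤∣transfer∣ = begin
      ∑[ g < n G ] (S-row g * T-row (lookup v g))
        ≡⟨ sum-cong-≗ (λ g → *-distribˡ-sum (S-row g) (λ h → [ t (lookup v g) h ])) ⟩
      ∑[ g < n G ] ∑[ h < n H ] (S-row g * [ t (lookup v g) h ])
        ≡⟨ sum-cong-≗ (λ g → sum-cong-≗ λ h → *-distribʳ-sum [ t (lookup v g) h ] (λ w → [ s g w ])) ⟩
      ∑[ g < n G ] ∑[ h < n H ] ∑[ w < n W ] ([ s g w ] * [ t (lookup v g) h ])
        ≡⟨ ∑-comm (λ g h → ∑[ w < n W ] ([ s g w ] * [ t (lookup v g) h ])) ⟩
      ∑[ h < n H ] ∑[ g < n G ] ∑[ w < n W ] ([ s g w ] * [ t (lookup v g) h ])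
        ≡⟨ sum-cong-≗ (λ h → ∑-comm (λ g w → [ s g w ] * [ t (lookup v g) h ])) ⟩
      ∑[ h < n H ] ∑[ w < n W ] ∑[ g < n G ] ([ s g w ] * [ t (lookup v g) h ])
        ≡⟨ sum-cong-≗ (λ h → sum-cong-≗ λ w → sum-cong-≗ λ g → [∧] (s g w) (t (lookup v g) h)) ⟨
      ∑[ h < n H ] ∑[ w < n W ] ∑[ g < n G ] [ link v h w g ]
        ≤⟨ ∑-mono (λ h → ∑-mono λ w → ∑[]≤[any] (link v h w) (transfer-witness-unique h w)) ⟩
      ∑[ h < n H ] ∑[ w < n W ] [ any (link v h w) ]
        ≡⟨ ∣⊠-tabulate∣ (λ h w → any (link v h w)) ⟨
      ∣ transfer v ∣ ∎
      where open ≤-Reasoning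

    ∑-rows≤α : ∑[ g < n G ] (S-row g * T-row (lookup v g)) ≤ α (H ⊠ W)
    ∑-rows≤α = ≤-trans ∑-rows≤∣transfer∣ (∣∣≤α (H ⊠ W) (transfer v) transfer-independent)

  ∑Aut-∑-rows :
    n G * ∑Aut G (λ v → ∑[ g < n G ] (S-row g * T-row (lookup v g))) ≡ #Aut G * (∣ S ∣ * ∣ T ∣)
  ∑Aut-∑-rows = begin
    n G * ∑Aut G (λ v → ∑[ g < n G ] (S-row g * T-row (lookup v g)))
      ≡⟨ cong (n G *_) (∑-sum-map (λ g v → S-row g * T-row (lookup v g)) (automorphisms G)) ⟨
    n G * (∑[ g < n G ] ∑Aut G (λ v → S-row g * T-row (lookup v g)))
      ≡⟨ cong (n G *_) (sum-cong-≗ λ g → sum-map-*ˡ (S-row g) (λ v → T-row (lookup v g)) (automorphisms G)) ⟨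
    n G * (∑[ g < n G ] (S-row g * ∑Aut G (λ v → T-row (lookup v g))))
      ≡⟨ *-distribˡ-sum (n G) (λ g → S-row g * ∑Aut G (λ v → T-row (lookup v g))) ⟩
    ∑[ g < n G ] (n G * (S-row g * ∑Aut G (λ v → T-row (lookup v g))))
      ≡⟨ sum-cong-≗ (λ g → trans (x*[y*z]≡y*[x*z] (n G) (S-row g) _)
                                 (cong (S-row g *_) (∑Aut-average G G-vt g T-row))) ⟩
    ∑[ g < n G ] (S-row g * (#Aut G * ∑ T-row))
      ≡⟨ *-distribʳ-sum (#Aut G * ∑ T-row) S-row ⟨
    ∑ S-row * (#Aut G * ∑ T-row)
      ≡⟨ cong₂ (λ a b → a * (#Aut G * b)) (∣∣≡∑∑ {n G} S) (∣∣≡∑∑ {n G} T) ⟨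
    ∣ S ∣ * (#Aut G * ∣ T ∣)
      ≡⟨ x*[y*z]≡y*[x*z] (∣ S ∣) (#Aut G) (∣ T ∣) ⟩
    #Aut G * (∣ S ∣ * ∣ T ∣) ∎
    where open ≡-Reasoning

  ∣S∣*∣T∣≤ : ∣ S ∣ * ∣ T ∣ ≤ n G * α (H ⊠ W)
  ∣S∣*∣T∣≤ = cancel-#Aut G (begin
    #Aut G * (∣ S ∣ * ∣ T ∣)
      ≡⟨ ∑Aut-∑-rows ⟨
    n G * ∑Aut G (λ v → ∑[ g < n G ] (S-row g * T-row (lookup v g)))
      ≤⟨ *-monoʳ-≤ (n G) (∑Aut-mono G ∑-rows≤α) ⟩
    n G * ∑Aut G (λ _ → α (H ⊠ W))
      ≡⟨ cong (n G *_) (∑Aut-const G (α (H ⊠ W))) ⟩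
    n G * (α (H ⊠ W) * #Aut G)
      ≡⟨ cong (n G *_) (*-comm (α (H ⊠ W)) (#Aut G)) ⟩
    n G * (#Aut G * α (H ⊠ W))
      ≡⟨ x*[y*z]≡y*[x*z] (n G) (#Aut G) _ ⟩
    #Aut G * (n G * α (H ⊠ W)) ∎)
    where open ≤-Reasoning

α-transfer-bound : ∀ G H W → VertexTransitive G → α (G ⊠ W) * α (G ᶜ ⊠ H) ≤ ∣V∣ G * α (H ⊠ W)
α-transfer-bound G H W G-vt =
  let S , S-indep , ∣S∣≡α = α-attained (G ⊠ W)
      T , T-indep , ∣T∣≡α = α-attained (G ᶜ ⊠ H)
  in subst₂ (λ a b → a * b ≤ ∣V∣ G * α (H ⊠ W)) ∣S∣≡α ∣T∣≡α
       (Transfer.∣S∣*∣T∣≤ G H W G-vt S S-indep T T-indep)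

-- Fractional colourings of vertex-transitive graphs

n*denom≤α*weight : ∀ K (c : FracColouring K) → n K * denom c ≤ α K * weightNum c
n*denom≤α*weight K c = begin
  n K * denom c
    ≡⟨ ∑-const (n K) (denom c) ⟨
  ∑[ x < n K ] denom c
    ≤⟨ ∑-mono (covers c) ⟩
  ∑[ x < n K ] sum (map proj₂ (filter (λ Sc → x ∈? proj₁ Sc) (sets c)))
    ≡⟨ sum-cong-≗ (λ x → sum-map-filter (λ Sc → x ∈? proj₁ Sc) proj₂ (sets c)) ⟩
  ∑[ x < n K ] sum (map (λ Sc → [ does (x ∈? proj₁ Sc) ] * proj₂ Sc) (sets c))
    ≡⟨ ∑-sum-map (λ x Sc → [ does (x ∈? proj₁ Sc) ] * proj₂ Sc) (sets c) ⟩
  sum (map (λ Sc → ∑[ x < n K ] ([ does (x ∈? proj₁ Sc) ] * proj₂ Sc)) (sets c))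
    ≡⟨ cong sum (map-cong size*weight (sets c)) ⟩
  sum (map (λ Sc → ∣ proj₁ Sc ∣ * proj₂ Sc) (sets c))
    ≤⟨ sum-map-mono (indep c) (λ Sc S-indep → *-monoˡ-≤ (proj₂ Sc) (∣∣≤α K (proj₁ Sc) S-indep)) ⟩
  sum (map (λ Sc → α K * proj₂ Sc) (sets c))
    ≡⟨ sum-map-*ˡ (α K) proj₂ (sets c) ⟨
  α K * weightNum c ∎
  where
  open ≤-Reasoning
  size*weight : ∀ (Sc : Subset (n K) × ℕ) →
    ∑[ x < n K ] ([ does (x ∈? proj₁ Sc) ] * proj₂ Sc) ≡ ∣ proj₁ Sc ∣ * proj₂ Sc
  size*weight (S , w) = trans (sum-cong-≗ (λ x → cong (λ b → [ b ] * w) (does-∈? x S)))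
    (trans (sym (*-distribʳ-sum w (λ x → [ lookup S x ]))) (cong (_* w) (sym (∣∣≡∑ S))))

-- Every automorphic image of a maximum independent set I gets weight ∣V∣ K, so that each vertex is
-- covered with total weight at least #Aut K * ∣ I ∣ without dividing by ∣V∣ K.
module OrbitColouring (K : Graph) (K-vt : VertexTransitive K) (1≤α : 1 ≤ α K) where

  I : Subset (n K)
  I = proj₁ (α-attained K)

  ∣I∣≡α : ∣ I ∣ ≡ α K
  ∣I∣≡α = proj₂ (proj₂ (α-attained K))

  orbit : Vec (Fin (n K)) (n K) → Subset (n K)
  orbit v = image (lookup v) I

  orbits : List (Subset (n K) × ℕ)
  orbits = map (λ v → orbit v , n K) (automorphisms K)

  covered : ∀ x → #Aut K * ∣ I ∣ ≤ ∑Aut K (λ v → [ lookup (orbit v) x ] * n K)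
  covered x = begin
    #Aut K * ∣ I ∣
      ≡⟨ cong (#Aut K *_) (∣∣≡∑ I) ⟩
    #Aut K * ∑[ y < n K ] [ lookup I y ]
      ≡⟨ *-distribˡ-sum (#Aut K) (λ y → [ lookup I y ]) ⟩
    ∑[ y < n K ] (#Aut K * [ lookup I y ])
      ≡⟨ sum-cong-≗ (λ y → trans (cong (_* [ lookup I y ]) (sym (n*#Maps≡#Aut K K-vt y x)))
                                 (*-assoc (n K) _ _)) ⟩
    ∑[ y < n K ] (n K * (#Maps K y x * [ lookup I y ]))
      ≡⟨ *-distribˡ-sum (n K) (λ y → #Maps K y x * [ lookup I y ]) ⟨
    n K * ∑[ y < n K ] (#Maps K y x * [ lookup I y ])
      ≡⟨ cong (n K *_) (sum-cong-≗ λ y → sum-map-*ʳ [ lookup I y ] _ (automorphisms K)) ⟩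
    n K * ∑[ y < n K ] ∑Aut K (λ v → [ ⌊ lookup v y ≟ x ⌋ ] * [ lookup I y ])
      ≡⟨ cong (n K *_) (∑-sum-map (λ y v → [ ⌊ lookup v y ≟ x ⌋ ] * [ lookup I y ]) (automorphisms K)) ⟩
    n K * ∑Aut K (λ v → ∑[ y < n K ] ([ ⌊ lookup v y ≟ x ⌋ ] * [ lookup I y ]))
      ≤⟨ *-monoʳ-≤ (n K) (∑Aut-mono K λ v v-aut → ∑-preimage≤image (lookup v) (proj₁ v-aut _ _) I x) ⟩
    n K * ∑Aut K (λ v → [ lookup (orbit v) x ])
      ≡⟨ *-comm (n K) _ ⟩
    ∑Aut K (λ v → [ lookup (orbit v) x ]) * n K
      ≡⟨ sum-map-*ʳ (n K) _ (automorphisms K) ⟩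
    ∑Aut K (λ v → [ lookup (orbit v) x ] * n K) ∎
    where open ≤-Reasoning

  colouring : FracColouring K
  colouring = record
    { sets = orbits
    ; denom = #Aut K * ∣ I ∣
    ; denom≥1 = *-mono-≤ (#Aut≥1 K) (≤-trans 1≤α (≤-reflexive (sym ∣I∣≡α)))
    ; indep = All-map⁺ (All.map (λ {v} v-aut →
                                   image-independent K K (lookup v) (automorphism-nonadj v v-aut) I I-indep)
                                (all-filter (isAutomorphismᵛ? K) (vectors (n K) (n K))))
    ; covers = λ x → ≤-trans (covered x) (≤-reflexive (sym (covers-count x)))
    }
    where
    I-indep : Independent K I
    I-indep = proj₁ (proj₂ (α-attained K))
    automorphism-nonadj : ∀ v → IsAutomorphismᵛ K v →
      ∀ y y′ → adj K y y′ ≡ false → adj K (lookup v y) (lookup v y′) ≡ false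
    automorphism-nonadj v (_ , pres) y y′ ¬adj = trans (pres y y′) ¬adj
    covers-count : ∀ x →
      sum (map proj₂ (filter (λ Sc → x ∈? proj₁ Sc) orbits)) ≡ ∑Aut K (λ v → [ lookup (orbit v) x ] * n K)
    covers-count x = begin
      sum (map proj₂ (filter (λ Sc → x ∈? proj₁ Sc) orbits))
        ≡⟨ sum-map-filter (λ Sc → x ∈? proj₁ Sc) proj₂ orbits ⟩
      sum (map (λ Sc → [ does (x ∈? proj₁ Sc) ] * proj₂ Sc) orbits)
        ≡⟨ cong sum (map-∘ (automorphisms K)) ⟨
      ∑Aut K (λ v → [ does (x ∈? orbit v) ] * n K)
        ≡⟨ cong sum (map-cong (λ v → cong (λ b → [ b ] * n K) (does-∈? x (orbit v))) (automorphisms K)) ⟩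
      ∑Aut K (λ v → [ lookup (orbit v) x ] * n K) ∎
      where open ≡-Reasoning

  weight*α≤n*denom : weightNum colouring * α K ≤ n K * denom colouring
  weight*α≤n*denom = ≤-reflexive (begin
    sum (map proj₂ orbits) * α K
      ≡⟨ cong (λ w → sum w * α K) (map-∘ (automorphisms K)) ⟨
    ∑Aut K (λ _ → n K) * α K
      ≡⟨ cong (_* α K) (∑Aut-const K (n K)) ⟩
    n K * #Aut K * α K
      ≡⟨ *-assoc (n K) _ _ ⟩
    n K * (#Aut K * α K)
      ≡⟨ cong (λ i → n K * (#Aut K * i)) ∣I∣≡α ⟨
    n K * (#Aut K * ∣ I ∣) ∎)
    where open ≡-Reasoning

χf-vertexTransitive : ∀ K → VertexTransitive K → 1 ≤ α K →
  ∀ a b → FracChromIs K a b → a * α K ≡ ∣V∣ K * b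
χf-vertexTransitive K K-vt 1≤α a b (optimal , approximable) = ≤-antisym a*α≤n*b n*b≤a*α
  where
  open OrbitColouring K K-vt 1≤α using (colouring; weight*α≤n*denom)
  a*α≤n*b : a * α K ≤ n K * b
  a*α≤n*b = *-cancelˡ-≤ (denom colouring) {{>-nonZero (denom≥1 colouring)}} (begin
    denom colouring * (a * α K)
      ≡⟨ x*[y*z]≡y*[x*z] (denom colouring) a (α K) ⟩
    a * (denom colouring * α K)
      ≡⟨ *-assoc a _ _ ⟨
    a * denom colouring * α K
      ≤⟨ *-monoˡ-≤ (α K) (optimal colouring) ⟩
    weightNum colouring * b * α K
      ≡⟨ trans (*-assoc (weightNum colouring) b (α K)) (x*[y*z]≡y*[x*z] (weightNum colouring) b (α K)) ⟩
    b * (weightNum colouring * α K)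
      ≤⟨ *-monoʳ-≤ b weight*α≤n*denom ⟩
    b * (n K * denom colouring)
      ≡⟨ x*[y*z]≡y*[x*z] b (n K) _ ⟩
    n K * (b * denom colouring)
      ≡⟨ cong (n K *_) (*-comm b _) ⟩
    n K * (denom colouring * b)
      ≡⟨ x*[y*z]≡y*[x*z] (n K) (denom colouring) b ⟩
    denom colouring * (n K * b) ∎)
    where open ≤-Reasoning
  n*b≤a*α : n K * b ≤ a * α K
  n*b≤a*α = ≮⇒≥ λ a*α<n*b →
    let c , weight*α<n*denom = approximable (n K) (α K) 1≤α a*α<n*b
    in <⇒≱ weight*α<n*denom (≤-trans (n*denom≤α*weight K c) (≤-reflexive (*-comm (α K) (weightNum c))))

AlphaStarLB-by-witness : ∀ G H W {a b} →
  Admissible W → α (H ⊠ W) ≤ b → a ≤ α (G ⊠ W) → AlphaStarLB G H a b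
AlphaStarLB-by-witness G H W {a} {b} W-adm α≤b a≤α p q _ p*b<a*q = W , W-adm , (begin-strict
  p * α (H ⊠ W) ≤⟨ *-monoʳ-≤ p α≤b ⟩
  p * b         <⟨ p*b<a*q ⟩
  a * q         ≤⟨ *-monoˡ-≤ q a≤α ⟩
  α (G ⊠ W) * q ∎)
  where open ≤-Reasoning

module _ (G H : Graph) (a a′ : ℕ) {b b′ : ℕ} (1≤b : 1 ≤ b) (a*b′≡a′*b : a * b′ ≡ a′ * b) where

  AlphaStarIs-rescale : AlphaStarIs G H a b → AlphaStarIs G H a′ b′
  AlphaStarIs-rescale (upper , lower) = upper′ , lower′
    where
    upper′ : AlphaStarUB G H a′ b′
    upper′ W W-adm = *-cancelˡ-≤ b {{>-nonZero 1≤b}} (begin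
      b * (α (G ⊠ W) * b′)  ≡⟨ cong (b *_) (*-comm (α (G ⊠ W)) b′) ⟩
      b * (b′ * α (G ⊠ W))  ≡⟨ x*[y*z]≡y*[x*z] b b′ _ ⟩
      b′ * (b * α (G ⊠ W))  ≡⟨ cong (b′ *_) (*-comm b _) ⟩
      b′ * (α (G ⊠ W) * b)  ≤⟨ *-monoʳ-≤ b′ (upper W W-adm) ⟩
      b′ * (a * α (H ⊠ W))  ≡⟨ x*[y*z]≡y*[x*z] b′ a _ ⟩
      a * (b′ * α (H ⊠ W))  ≡⟨ *-assoc a b′ _ ⟨
      a * b′ * α (H ⊠ W)    ≡⟨ cong (_* α (H ⊠ W)) (trans a*b′≡a′*b (*-comm a′ b)) ⟩
      b * a′ * α (H ⊠ W)    ≡⟨ *-assoc b a′ _ ⟩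
      b * (a′ * α (H ⊠ W)) ∎)
      where open ≤-Reasoning
    lower′ : AlphaStarLB G H a′ b′
    lower′ p q 1≤q p*b′<a′*q = lower p q 1≤q (*-cancelˡ-< b′ _ _ (begin-strict
      b′ * (p * b)   ≡⟨ x*[y*z]≡y*[x*z] b′ p b ⟩
      p * (b′ * b)   ≡⟨ cong (p *_) (*-comm b′ b) ⟩
      p * (b * b′)   ≡⟨ x*[y*z]≡y*[x*z] p b b′ ⟩
      b * (p * b′)   <⟨ *-monoʳ-< b {{>-nonZero 1≤b}} p*b′<a′*q ⟩
      b * (a′ * q)   ≡⟨ *-assoc b a′ q ⟨
      b * a′ * q     ≡⟨ cong (_* q) (trans (*-comm b a′) (sym a*b′≡a′*b)) ⟩
      a * b′ * q     ≡⟨ cong (_* q) (*-comm a b′) ⟩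
      b′ * a * q     ≡⟨ *-assoc b′ a q ⟩
      b′ * (a * q) ∎))
      where open ≤-Reasoning

corollary3 : (G H : Graph) → IsSimple G → IsSimple H → 1 ≤ ∣V∣ G → 1 ≤ ∣V∣ H →
  VertexTransitive G →
    AlphaStarIs G H (∣V∣ G) (α (G ᶜ ⊠ H))
    × AlphaStarLB (H ᶜ) (G ᶜ) (∣V∣ H) (α (G ᶜ ⊠ H))
    × (VertexTransitive H →
         AlphaStarIs (H ᶜ) (G ᶜ) (∣V∣ H) (α (G ᶜ ⊠ H))
         × (∀ a b → 1 ≤ b → FracChromIs (G ᶜ ⊠ H) a b →
              AlphaStarIs G H a (b * ∣V∣ H)))
corollary3 G H G-simple H-simple 1≤∣G∣ 1≤∣H∣ G-vt =
  α*[G∣H] , α*[Hᶜ∣Gᶜ]-lower , λ H-vt → (α*[Hᶜ∣Gᶜ]-upper H-vt , α*[Hᶜ∣Gᶜ]-lower) , χf-form H-vt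
  where
  α*[G∣H] : AlphaStarIs G H (∣V∣ G) (α (G ᶜ ⊠ H))
  α*[G∣H] = (λ W _ → α-transfer-bound G H W G-vt) ,
            AlphaStarLB-by-witness G H (G ᶜ) (ᶜ-simple G G-simple , 1≤∣G∣) (α-⊠-comm H (G ᶜ)) (∣V∣≤α-⊠ᶜ G)

  α*[Hᶜ∣Gᶜ]-lower : AlphaStarLB (H ᶜ) (G ᶜ) (∣V∣ H) (α (G ᶜ ⊠ H))
  α*[Hᶜ∣Gᶜ]-lower = AlphaStarLB-by-witness (H ᶜ) (G ᶜ) H (H-simple , 1≤∣H∣) ≤-refl
    (≤-trans (∣V∣≤α-⊠ᶜ H) (α-⊠-comm H (H ᶜ)))

  α*[Hᶜ∣Gᶜ]-upper : VertexTransitive H → AlphaStarUB (H ᶜ) (G ᶜ) (∣V∣ H) (α (G ᶜ ⊠ H))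
  α*[Hᶜ∣Gᶜ]-upper H-vt W _ = ≤-trans
    (*-monoʳ-≤ (α (H ᶜ ⊠ W)) (≤-trans (α-⊠-comm (G ᶜ) H) (α-⊠-ᶜᶜ H (G ᶜ) H-simple)))
    (α-transfer-bound (H ᶜ) (G ᶜ) W (ᶜ-vertexTransitive H H-vt))

  χf-form : VertexTransitive H → ∀ a b → 1 ≤ b → FracChromIs (G ᶜ ⊠ H) a b → AlphaStarIs G H a (b * ∣V∣ H)
  χf-form H-vt a b _ χf≡a/b = AlphaStarIs-rescale G H (∣V∣ G) a 1≤α ∣G∣*[b*∣H∣]≡a*α α*[G∣H]
    where
    1≤α : 1 ≤ α (G ᶜ ⊠ H)
    1≤α = 1≤α-⊠ (G ᶜ) H 1≤∣G∣ 1≤∣H∣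
    ∣G∣*[b*∣H∣]≡a*α : ∣V∣ G * (b * ∣V∣ H) ≡ a * α (G ᶜ ⊠ H)
    ∣G∣*[b*∣H∣]≡a*α = begin
      ∣V∣ G * (b * ∣V∣ H)   ≡⟨ cong (∣V∣ G *_) (*-comm b (∣V∣ H)) ⟩
      ∣V∣ G * (∣V∣ H * b)   ≡⟨ *-assoc (∣V∣ G) (∣V∣ H) b ⟨
      ∣V∣ G * ∣V∣ H * b     ≡⟨ χf-vertexTransitive (G ᶜ ⊠ H) Gᶜ⊠H-vt 1≤α a b χf≡a/b ⟨
      a * α (G ᶜ ⊠ H) ∎
      where
      open ≡-Reasoning
      Gᶜ⊠H-vt = ⊠-vertexTransitive (G ᶜ) H (ᶜ-vertexTransitive G G-vt) H-vt
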